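{- Let $(U,\varphi)$ be a finite standard closure space whose lattice of closed sets is geometric. Then the (aggregated) $E$-base of $(U,\varphi)$ is valid if and only if the essential sets of $(U,\varphi)$ are pairwise incomparable under inclusion.
   Context: A closure space $(U,\varphi)$: finite $U$ with closure operator $\varphi$; closed sets form a lattice under inclusion. Standard: $\varphi(\{x\})\setminus\{x\}$ closed for all $x$. Geometric lattice: atomistic (every join-irreducible element covers the bottom) and upper-semimodular. Quasi-closed $Q$: for all $X\subseteq Q$ with $\varphi(X)\subsetneq\varphi(Q)$, $\varphi(X)\subseteq Q$. Pseudo-closed $P$: not closed and inclusion-minimal among quasi-closed $Q$ with $\varphi(Q)=\varphi(P)$. Essential set: $\varphi(P)$ for $P$ pseudo-closed. $\varphi^b(X)=\bigcup_{x\in X}\varphi(\{x\})$. $D$-generator of $x$: $A$ with $x\in\varphi(A)$, $x\notin\varphi^b(A)$, and $x\notin\varphi(B)$ whenever $\varphi^b(B)\subsetneq\varphi^b(A)$. $E$-generator of $x$: $D$-generator $A$ with $\varphi(A)$ inclusion-minimal among closures of $D$-generators of $x$. The $E$-base is $\Sigma_E=\{a\to x: x\neq a,x\in\varphi(\{a\})\}\cup\{A\to x: A \text{ an } E\text{ -generator of } x\}$ (aggregated: implications with equal premises merged). A set $\Sigma$ of implications induces the closure operator whose closed sets $C$ satisfy $A\subseteq C\Rightarrow X\subseteq C$ for all $A\to X\in\Sigma$; $\Sigma_E$ is valid if this operator equals $\varphi$. -}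

module Defs where

open import Data.Nat using (ℕ)
open import Data.Fin using (Fin)
open import Data.Fin.Subset using (Subset; ⊥; ⁅_⁆; _∈_; _∉_; _⊆_; _⊂_; _∪_; _∩_; _-_)
open import Data.Product using (Σ; ∃; ∃-syntax; _×_; _,_)
open import Data.Sum using (_⊎_)
open import Relation.Nullary using (¬_)
open import Relation.Binary.PropositionalEquality using (_≡_; _≢_)
open import Function.Bundles using (_⇔_)

-- A closure operator on the finite set U = Fin n (subsets of U are
-- Data.Fin.Subset n, i.e. characteristic vectors).
record ClosureOperator (n : ℕ) : Set where
  field
    φ         : Subset n → Subset n
    extensive : ∀ X → X ⊆ φ X
    monotone  : ∀ {X Y} → X ⊆ Y → φ X ⊆ φ Y
    idempotent : ∀ X → φ (φ X) ≡ φ X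

module _ {n : ℕ} (cl : ClosureOperator n) where
  open ClosureOperator cl

  Closed : Subset n → Set
  Closed X = φ X ≡ X

  Standard : Set
  Standard = ∀ x → Closed (φ ⁅ x ⁆ - x)

  -- The lattice of closed sets (order ⊆, bottom φ ∅, join φ(C ∪ D),
  -- meet C ∩ D).

  Bottom : Subset n
  Bottom = φ ⊥

  Covers : Subset n → Subset n → Set
  Covers C D = Closed C × Closed D × C ⊂ D
             × (∀ E → Closed E → C ⊂ E → ¬ (E ⊂ D))

  JoinIrreducible : Subset n → Set
  JoinIrreducible C = Closed C × C ≢ Bottom
    × (∀ A B → Closed A → Closed B → C ≡ φ (A ∪ B) → C ≡ A ⊎ C ≡ B)

  Atomistic : Set
  Atomistic = ∀ C → JoinIrreducible C → Covers Bottom C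

  UpperSemimodular : Set
  UpperSemimodular = ∀ A B → Closed A → Closed B →
    Covers (A ∩ B) A → Covers B (φ (A ∪ B))

  Geometric : Set
  Geometric = Atomistic × UpperSemimodular

  QuasiClosed : Subset n → Set
  QuasiClosed Q = ∀ X → X ⊆ Q → φ X ⊂ φ Q → φ X ⊆ Q

  PseudoClosed : Subset n → Set
  PseudoClosed P = ¬ Closed P × QuasiClosed P
    × (∀ Q → QuasiClosed Q → φ Q ≡ φ P → ¬ (Q ⊂ P))

  Essential : Subset n → Set
  Essential E = ∃[ P ] (PseudoClosed P × φ P ≡ E)

  EssentialPairwiseIncomparable : Set
  EssentialPairwiseIncomparable = ∀ E F → Essential E → Essential F →
    E ⊆ F → E ≡ F

  -- φ^b(X) = ⋃_{x ∈ X} φ({x}), given by its membership predicate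

  _∈ᵇ_ : Fin n → Subset n → Set
  y ∈ᵇ X = ∃[ x ] (x ∈ X × y ∈ φ ⁅ x ⁆)

  _⊂ᵇ_ : Subset n → Subset n → Set
  B ⊂ᵇ A = (∀ y → y ∈ᵇ B → y ∈ᵇ A) × ∃[ y ] (y ∈ᵇ A × ¬ (y ∈ᵇ B))

  DGenerator : Fin n → Subset n → Set
  DGenerator x A = x ∈ φ A × ¬ (x ∈ᵇ A)
    × (∀ B → B ⊂ᵇ A → x ∉ φ B)

  EGenerator : Fin n → Subset n → Set
  EGenerator x A = DGenerator x A × (∀ B → DGenerator x B → ¬ (φ B ⊂ φ A))

  -- The aggregated E-base: for each premise A, the conclusion is the set
  -- of all x with A → x in Σ_E (binary part a → x with A = {a}, x ≠ a,
  -- x ∈ φ({a}); plus A → x for A an E-generator of x).  Premises with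
  -- empty conclusion contribute nothing.

  InConclusion : Subset n → Fin n → Set
  InConclusion A x =
      (∃[ a ] (A ≡ ⁅ a ⁆ × x ≢ a × x ∈ φ ⁅ a ⁆))
    ⊎ EGenerator x A

  EBaseClosed : Subset n → Set
  EBaseClosed C = ∀ A → A ⊆ C → ∀ x → InConclusion A x → x ∈ C

  _∈EBaseClosure_ : Fin n → Subset n → Set
  x ∈EBaseClosure X = ∀ C → EBaseClosed C → X ⊆ C → x ∈ C

  EBaseValid : Set
  EBaseValid = ∀ X x → (x ∈EBaseClosure X) ⇔ (x ∈ φ X)

module Submission where

-- In a standard geometric closure space every singleton is closed, so D-generators
-- are simply minimal generators not containing their target, and upper
-- semimodularity yields the exchange property.
--
-- If essential sets are incomparable and C is Σ_E-closed but not closed, take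
-- X ⊆ C with φ X ⊈ C and φ X minimal; then φ X is essential, and a minimal
-- generator inside X of a point of φ X ∖ C is an E-generator, since a D-generator
-- with smaller closure would sit above an essential set strictly below φ X.
--
-- Conversely, let φ P ⊊ φ P' be essential.  An E-generator A ⊆ P' of a point
-- outside P' has φ A = φ P', and a point e ∈ φ P ∖ P is generated strictly below
-- φ A.  Removing from A a point c of a minimal generator of e, the points of φ A
-- lying in φ (A - c) or not generated strictly below φ A form a Σ_E-closed set
-- which spans φ A (by exchange) but misses e, contradicting validity.  Hence P'
-- is Σ_E-closed, and validity would make the pseudo-closed set P' closed.

open import Defs
open import Data.Nat using (ℕ)
open import Data.Bool using (_≟_)
open import Data.Empty using (⊥-elim)
open import Data.Fin using (Fin; zero; suc)
open import Data.Fin.Properties using (any?) renaming (_≟_ to _≟ᶠ_)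
open import Data.Fin.Subset using (Subset; Nonempty; ⊥; ⁅_⁆; _∈_; _∉_; _⊆_; _⊈_; _⊂_; _∪_; _∩_; _-_)
open import Data.Fin.Subset.Properties
  using (_∈?_; _⊆?_; _⊂?_; anySubset?; ⊆-refl; ⊆-trans; ⊆-antisym; ⊆-⊂-trans; p⊂q⇒p⊆q; ⊥⊆; ∉⊥;
         Empty-unique; x∈⁅x⁆; x∈⁅y⁆⇒x≡y; p⊆p∪q; q⊆p∪q; x∈p∪q⁻; x∈p∩q⁺; x∈p∩q⁻; p∩q⊆p; p∩q⊆q;
         p─q⊆p; x∈p∧x≢y⇒x∈p-y; x∈p⇒p-x⊂p)
open import Data.Fin.Subset.Induction using (⊂-wellFounded)
open import Data.Vec using (_∷_; there; tabulate)
open import Data.Vec.Properties using (≡-dec; lookup∘tabulate; lookup⇒[]=; []=⇒lookup)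
open import Data.Product using (∃-syntax; _×_; _,_; proj₁; proj₂)
open import Data.Sum using (_⊎_; inj₁; inj₂; [_,_]) renaming (map to ⊎-map)
open import Function using (_∘_; _on_)
open import Function.Bundles using (_⇔_; mk⇔; Equivalence)
open import Induction.WellFounded using (Acc; acc)
open import Level using (Level)
import Relation.Binary.Construct.On as On
open import Relation.Binary.PropositionalEquality using (_≡_; _≢_; refl; sym; trans; subst)
open import Relation.Nullary using (¬_; Dec; yes; no; does; contradiction)
open import Relation.Nullary.Decidable
  using (_×-dec_; _⊎-dec_; ¬?; decidable-stable; dec-true; dec-false)
open import Relation.Unary using (Pred; Decidable)

open Equivalence using (to; from)

module SubsetProperties where

  private
    variable
      n : ℕ
      ℓ : Level
      x y : Fin n
      p q r : Subset n

  _≟ˢ_ : (p q : Subset n) → Dec (p ≡ q)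
  _≟ˢ_ = ≡-dec _≟_

  ⊈⇒∃∉ : p ⊈ q → ∃[ x ] (x ∈ p × x ∉ q)
  ⊈⇒∃∉ {p = p} {q = q} p⊈q with any? (λ x → (x ∈? p) ×-dec ¬? (x ∈? q))
  ... | yes witness = witness
  ... | no none = contradiction
    (λ {x} x∈p → decidable-stable (x ∈? q) (λ x∉q → none (x , x∈p , x∉q))) p⊈q

  ⊆∧≢⇒⊂ : p ⊆ q → p ≢ q → p ⊂ q
  ⊆∧≢⇒⊂ p⊆q p≢q = p⊆q , ⊈⇒∃∉ (p≢q ∘ ⊆-antisym p⊆q)

  ∪-least : p ⊆ r → q ⊆ r → p ∪ q ⊆ r
  ∪-least p⊆r q⊆r x∈p∪q = [ p⊆r , q⊆r ] (x∈p∪q⁻ _ _ x∈p∪q)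

  x∈p⇒⁅x⁆⊆p : x ∈ p → ⁅ x ⁆ ⊆ p
  x∈p⇒⁅x⁆⊆p {p = p} x∈p y∈⁅x⁆ = subst (_∈ p) (sym (x∈⁅y⁆⇒x≡y _ y∈⁅x⁆)) x∈p

  x∉p⇒⁅x⁆∩p≡⊥ : x ∉ p → ⁅ x ⁆ ∩ p ≡ ⊥
  x∉p⇒⁅x⁆∩p≡⊥ {p = p} x∉p = Empty-unique λ (y , y∈⁅x⁆∩p) →
    let y∈⁅x⁆ , y∈p = x∈p∩q⁻ _ _ y∈⁅x⁆∩p in x∉p (subst (_∈ p) (x∈⁅y⁆⇒x≡y _ y∈⁅x⁆) y∈p)

  x∉p-x : (p : Subset n) (x : Fin n) → x ∉ p - x
  x∉p-x (_ ∷ p) zero    ()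
  x∉p-x (_ ∷ p) (suc x) (there x∈p-x) = x∉p-x p x x∈p-x

  p⊆q⇒p-x⊆q-x : p ⊆ q → p - x ⊆ q - x
  p⊆q⇒p-x⊆q-x {p = p} p⊆q y∈p-x =
    x∈p∧x≢y⇒x∈p-y (p⊆q (p─q⊆p p _ y∈p-x)) λ { refl → x∉p-x p _ y∈p-x }

  p-x⊆q∧x∈q⇒p⊆q : p - x ⊆ q → x ∈ q → p ⊆ q
  p-x⊆q∧x∈q⇒p⊆q {x = x} p-x⊆q x∈q {y} y∈p with y ≟ᶠ x
  ... | yes refl = x∈q
  ... | no y≢x   = p-x⊆q (x∈p∧x≢y⇒x∈p-y y∈p y≢x)

  p⊆p-x∪⁅x⁆ : (p : Subset n) (x : Fin n) → p ⊆ (p - x) ∪ ⁅ x ⁆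
  p⊆p-x∪⁅x⁆ p x = p-x⊆q∧x∈q⇒p⊆q (p⊆p∪q _) (q⊆p∪q _ _ (x∈⁅x⁆ x))

  select : {P : Pred (Fin n) ℓ} → Decidable P → Subset n
  select P? = tabulate (does ∘ P?)

  module _ {n : ℕ} {P : Pred (Fin n) ℓ} (P? : Decidable P) where

    ∈-select⁺ : P x → x ∈ select P?
    ∈-select⁺ {x} Px = lookup⇒[]= x _ (trans (lookup∘tabulate _ x) (dec-true (P? x) Px))

    ∈-select⁻ : x ∈ select P? → P x
    ∈-select⁻ {x} x∈ = decidable-stable (P? x) λ ¬Px →
      contradiction (trans (sym (trans (sym (lookup∘tabulate _ x)) ([]=⇒lookup x∈)))
                           (dec-false (P? x) ¬Px))
                    λ ()

  module _ {n : ℕ} {P : Pred (Subset n) ℓ} (P? : Decidable P) (f : Subset n → Subset n) where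

    ⊂-minimal-on : ∀ {X} → P X → ∃[ Y ] (P Y × f Y ⊆ f X × (∀ Z → f Z ⊂ f Y → ¬ P Z))
    ⊂-minimal-on {X} = go X (On.wellFounded f ⊂-wellFounded X)
      where
      go : ∀ X → Acc (_⊂_ on f) X → P X →
           ∃[ Y ] (P Y × f Y ⊆ f X × (∀ Z → f Z ⊂ f Y → ¬ P Z))
      go X (acc below) PX with anySubset? (λ Z → (f Z ⊂? f X) ×-dec P? Z)
      ... | no none = X , PX , ⊆-refl , λ Z fZ⊂fX PZ → none (Z , fZ⊂fX , PZ)
      ... | yes (Z , fZ⊂fX , PZ) =
        let Y , PY , fY⊆fZ , minimal = go Z (below fZ⊂fX) PZ
        in  Y , PY , ⊆-trans fY⊆fZ (p⊂q⇒p⊆q fZ⊂fX) , minimal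

open SubsetProperties

module ClosureSpace {n : ℕ} (cl : ClosureOperator n) where
  open ClosureOperator cl

  private
    variable
      x c : Fin n
      A C Q X Y Z : Subset n

  ⊆φ⇒φ⊆φ : X ⊆ φ Y → φ X ⊆ φ Y
  ⊆φ⇒φ⊆φ {X} {Y} X⊆φY = subst (φ X ⊆_) (idempotent Y) (monotone X⊆φY)

  MinimalGenerator : Fin n → Subset n → Set
  MinimalGenerator x A = x ∈ φ A × (∀ B → B ⊂ A → x ∉ φ B)

  minimalGenerator : x ∈ φ A → ∃[ B ] (B ⊆ A × MinimalGenerator x B)
  minimalGenerator {x} x∈φA =
    let B , x∈φB , B⊆A , minimal = ⊂-minimal-on (λ B → x ∈? φ B) (λ B → B) x∈φA
    in  B , B⊆A , x∈φB , minimal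

  MinimalGenerator⇒∉φ- : MinimalGenerator x A → c ∈ A → x ∉ φ (A - c)
  MinimalGenerator⇒∉φ- {A = A} (_ , minimal) c∈A = minimal (A - _) (x∈p⇒p-x⊂p c∈A)

  quasiClosed? : Decidable (QuasiClosed cl)
  quasiClosed? Q with anySubset? (λ X → (X ⊆? Q) ×-dec (φ X ⊂? φ Q) ×-dec ¬? (φ X ⊆? Q))
  ... | yes (X , X⊆Q , φX⊂φQ , φX⊈Q) = no λ qcQ → φX⊈Q (qcQ X X⊆Q φX⊂φQ)
  ... | no none = yes λ X X⊆Q φX⊂φQ →
    decidable-stable (φ X ⊆? Q) (λ φX⊈Q → none (X , X⊆Q , φX⊂φQ , φX⊈Q))

  pseudoClosed-below : QuasiClosed cl Q → ¬ Closed cl Q → ∃[ P ] (PseudoClosed cl P × φ P ≡ φ Q)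
  pseudoClosed-below {Q} qcQ ¬cQ
    with ⊂-minimal-on (λ P → quasiClosed? P ×-dec (φ P ≟ˢ φ Q)) (λ P → P) (qcQ , refl)
  ... | P , (qcP , φP≡φQ) , P⊆Q , minimal =
    P , (¬cP , qcP , λ R qcR φR≡φP R⊂P → minimal R R⊂P (qcR , trans φR≡φP φP≡φQ)) , φP≡φQ
    where
    ¬cP : ¬ Closed cl P
    ¬cP cP = ¬cQ (⊆-antisym (subst (_⊆ Q) (trans (sym cP) φP≡φQ) P⊆Q) (extensive Q))

  Escape : Subset n → Subset n → Set
  Escape C X = X ⊆ C × φ X ⊈ C

  MinimalEscape : Subset n → Subset n → Set
  MinimalEscape C X = Escape C X × (∀ Z → φ Z ⊂ φ X → Z ⊆ C → φ Z ⊆ C)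

  minimalEscape : Escape C X → ∃[ Y ] (MinimalEscape C Y × φ Y ⊆ φ X)
  minimalEscape {C} escX
    with ⊂-minimal-on (λ X → (X ⊆? C) ×-dec ¬? (φ X ⊆? C)) φ escX
  ... | Y , escY , φY⊆φX , minimal = Y , (escY , inC) , φY⊆φX
    where
    inC : ∀ Z → φ Z ⊂ φ Y → Z ⊆ C → φ Z ⊆ C
    inC Z φZ⊂φY Z⊆C = decidable-stable (φ Z ⊆? C) λ φZ⊈C → minimal Z φZ⊂φY (Z⊆C , φZ⊈C)

  MinimalEscape⇒Essential : MinimalEscape C X → Essential cl (φ X)
  MinimalEscape⇒Essential {C} {X} ((X⊆C , φX⊈C) , minimal) =
    let P , pcP , φP≡φS = pseudoClosed-below qcS ¬cS in P , pcP , trans φP≡φS φS≡φX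
    where
    S : Subset n
    S = C ∩ φ X
    φS≡φX : φ S ≡ φ X
    φS≡φX = ⊆-antisym (⊆φ⇒φ⊆φ (p∩q⊆q C (φ X)))
                      (monotone λ x∈X → x∈p∩q⁺ (X⊆C x∈X , extensive X x∈X))
    qcS : QuasiClosed cl S
    qcS W W⊆S φW⊂φS x∈φW =
      x∈p∩q⁺ (minimal W φW⊂φX (⊆-trans W⊆S (p∩q⊆p C (φ X))) x∈φW , proj₁ φW⊂φX x∈φW)
      where
      φW⊂φX : φ W ⊂ φ X
      φW⊂φX = subst (φ W ⊂_) φS≡φX φW⊂φS
    ¬cS : ¬ Closed cl S
    ¬cS cS = φX⊈C (subst (_⊆ C) (trans (sym cS) φS≡φX) (p∩q⊆p C (φ X)))

  Essential-below : φ Z ⊈ Z → ∃[ E ] (Essential cl E × E ⊆ φ Z)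
  Essential-below φZ⊈Z =
    let Y , minEscY , φY⊆φZ = minimalEscape (⊆-refl , φZ⊈Z)
    in  φ Y , MinimalEscape⇒Essential minEscY , φY⊆φZ

  φ-EBaseClosed : ∀ X → EBaseClosed cl (φ X)
  φ-EBaseClosed X A A⊆φX x (inj₁ (a , refl , _ , x∈φa)) = ⊆φ⇒φ⊆φ A⊆φX x∈φa
  φ-EBaseClosed X A A⊆φX x (inj₂ ((x∈φA , _) , _))     = ⊆φ⇒φ⊆φ A⊆φX x∈φA

  EBaseValid⇔EBaseClosed⇒closed : EBaseValid cl ⇔ (∀ C → EBaseClosed cl C → φ C ⊆ C)
  EBaseValid⇔EBaseClosed⇒closed = mk⇔ valid⇒closed closed⇒valid
    where
    valid⇒closed : EBaseValid cl → ∀ C → EBaseClosed cl C → φ C ⊆ C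
    valid⇒closed valid C ebcC x∈φC = from (valid C _) x∈φC C ebcC ⊆-refl
    closed⇒valid : (∀ C → EBaseClosed cl C → φ C ⊆ C) → EBaseValid cl
    closed⇒valid closed X x = mk⇔
      (λ x∈ΣX → x∈ΣX (φ X) (φ-EBaseClosed X) (extensive X))
      (λ x∈φX C ebcC (X⊆C : X ⊆ C) → closed C ebcC (monotone X⊆C x∈φX))

  GeneratedBelow : Subset n → Fin n → Set
  GeneratedBelow F z = ∃[ B ] (z ∉ B × z ∈ φ B × φ B ⊂ F)

  generatedBelow? : ∀ F → Decidable (GeneratedBelow F)
  generatedBelow? F z = anySubset? λ B → ¬? (z ∈? B) ×-dec (z ∈? φ B) ×-dec (φ B ⊂? F)

module GeometricClosureSpace {n : ℕ} (cl : ClosureOperator n) (standard : Standard cl)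
                             (atomistic : Atomistic cl) (semimodular : UpperSemimodular cl) where
  open ClosureOperator cl
  open ClosureSpace cl

  private
    variable
      x y c e : Fin n
      A B C F X : Subset n

  ∉φ⊥ : x ∉ φ ⊥
  ∉φ⊥ {x} x∈φ⊥ = x∉p-x (φ ⁅ x ⁆) x (subst (x ∈_) (standard x) (monotone ⊥⊆ x∈φ⊥))

  φ⊥≡⊥ : φ ⊥ ≡ ⊥
  φ⊥≡⊥ = Empty-unique (∉φ⊥ ∘ proj₂)

  ∈φ⇒Nonempty : x ∈ φ A → Nonempty A
  ∈φ⇒Nonempty x∈φA =
    let a , a∈A , _ = ⊈⇒∃∉ {q = ⊥} λ A⊆⊥ → ∉φ⊥ (monotone A⊆⊥ x∈φA) in a , a∈A

  x∈φ⁅x⁆ : ∀ x → x ∈ φ ⁅ x ⁆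
  x∈φ⁅x⁆ x = extensive ⁅ x ⁆ (x∈⁅x⁆ x)

  φ⁅x⁆-joinIrreducible : ∀ x → JoinIrreducible cl (φ ⁅ x ⁆)
  φ⁅x⁆-joinIrreducible x =
    idempotent ⁅ x ⁆ , (λ φ⁅x⁆≡φ⊥ → ∉φ⊥ (subst (x ∈_) φ⁅x⁆≡φ⊥ (x∈φ⁅x⁆ x))) , irreducible
    where
    irreducible : ∀ A B → Closed cl A → Closed cl B → φ ⁅ x ⁆ ≡ φ (A ∪ B) →
                  φ ⁅ x ⁆ ≡ A ⊎ φ ⁅ x ⁆ ≡ B
    irreducible A B cA cB φ⁅x⁆≡φA∪B =
      ⊎-map (φ⁅x⁆≡ cA (p⊆p∪q B)) (φ⁅x⁆≡ cB (q⊆p∪q A B)) (x∈p∪q⁻ A B x∈A∪B)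
      where
      A∪B⊆φ⁅x⁆ : A ∪ B ⊆ φ ⁅ x ⁆
      A∪B⊆φ⁅x⁆ y∈A∪B = subst (_ ∈_) (sym φ⁅x⁆≡φA∪B) (extensive _ y∈A∪B)
      φ⁅x⁆≡ : ∀ {D} → Closed cl D → D ⊆ A ∪ B → x ∈ D → φ ⁅ x ⁆ ≡ D
      φ⁅x⁆≡ cD D⊆A∪B x∈D = ⊆-antisym (subst (φ ⁅ x ⁆ ⊆_) cD (monotone (x∈p⇒⁅x⁆⊆p x∈D)))
                                     (λ y∈D → A∪B⊆φ⁅x⁆ (D⊆A∪B y∈D))
      A∪B⊆φ⁅x⁆-x : x ∉ A ∪ B → A ∪ B ⊆ φ ⁅ x ⁆ - x
      A∪B⊆φ⁅x⁆-x x∉A∪B y∈A∪B = x∈p∧x≢y⇒x∈p-y (A∪B⊆φ⁅x⁆ y∈A∪B) λ { refl → x∉A∪B y∈A∪B }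
      x∈A∪B : x ∈ A ∪ B
      x∈A∪B = decidable-stable (x ∈? A ∪ B) λ x∉A∪B →
        x∉p-x (φ ⁅ x ⁆) x (subst (φ (A ∪ B) ⊆_) (standard x) (monotone (A∪B⊆φ⁅x⁆-x x∉A∪B))
                             (subst (x ∈_) φ⁅x⁆≡φA∪B (x∈φ⁅x⁆ x)))

  ∈φ⁅x⁆⇒≡ : y ∈ φ ⁅ x ⁆ → y ≡ x
  ∈φ⁅x⁆⇒≡ {y} {x} y∈φ⁅x⁆ with y ≟ᶠ x
  ... | yes y≡x = y≡x
  ... | no y≢x  =
    let _ , _ , _ , nothing-between = atomistic (φ ⁅ x ⁆) (φ⁅x⁆-joinIrreducible x)
    in  ⊥-elim (nothing-between (φ ⁅ x ⁆ - x) (standard x)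
                  ((λ z∈φ⊥ → contradiction z∈φ⊥ ∉φ⊥) , y , x∈p∧x≢y⇒x∈p-y y∈φ⁅x⁆ y≢x , ∉φ⊥)
                  (p─q⊆p _ _ , x , x∈φ⁅x⁆ x , x∉p-x _ x))

  φ⁅x⁆≡⁅x⁆ : ∀ x → φ ⁅ x ⁆ ≡ ⁅ x ⁆
  φ⁅x⁆≡⁅x⁆ x = ⊆-antisym (λ y∈φ⁅x⁆ → subst (_∈ ⁅ x ⁆) (sym (∈φ⁅x⁆⇒≡ y∈φ⁅x⁆)) (x∈⁅x⁆ x))
                         (extensive ⁅ x ⁆)

  ⊥⋖⁅x⁆ : ∀ x → Covers cl ⊥ ⁅ x ⁆
  ⊥⋖⁅x⁆ x = φ⊥≡⊥ , φ⁅x⁆≡⁅x⁆ x , (⊥⊆ , x , x∈⁅x⁆ x , ∉⊥) ,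
    λ { E _ (_ , y , y∈E , _) (E⊆⁅x⁆ , z , z∈⁅x⁆ , z∉E) →
        z∉E (subst (_∈ E) (trans (x∈⁅y⁆⇒x≡y x (E⊆⁅x⁆ y∈E)) (sym (x∈⁅y⁆⇒x≡y x z∈⁅x⁆))) y∈E) }

  φX⋖φ⁅x⁆∪φX : x ∉ φ X → Covers cl (φ X) (φ (⁅ x ⁆ ∪ φ X))
  φX⋖φ⁅x⁆∪φX {x} {X} x∉φX = semimodular ⁅ x ⁆ (φ X) (φ⁅x⁆≡⁅x⁆ x) (idempotent X)
    (subst (λ B → Covers cl B ⁅ x ⁆) (sym (x∉p⇒⁅x⁆∩p≡⊥ x∉φX)) (⊥⋖⁅x⁆ x))

  -- φ (⁅ y ⁆ ∪ φ X) ⊆ φ (⁅ x ⁆ ∪ φ X) both cover φ X, so they are equal.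
  exchange : y ∈ φ (X ∪ ⁅ x ⁆) → y ∉ φ X → x ∈ φ (X ∪ ⁅ y ⁆)
  exchange {y} {X} {x} y∈φX∪x y∉φX = ⊆φ⇒φ⊆φ ⁅y⁆∪φX⊆φX∪y x∈Dy
    where
    Dx Dy : Subset n
    Dx = φ (⁅ x ⁆ ∪ φ X)
    Dy = φ (⁅ y ⁆ ∪ φ X)
    x∉φX : x ∉ φ X
    x∉φX x∈φX = y∉φX (⊆φ⇒φ⊆φ (∪-least (extensive X) (x∈p⇒⁅x⁆⊆p x∈φX)) y∈φX∪x)
    y∈Dx : y ∈ Dx
    y∈Dx = monotone (∪-least (λ z∈X → q⊆p∪q _ _ (extensive X z∈X)) (p⊆p∪q _)) y∈φX∪x
    Dy⊆Dx : Dy ⊆ Dx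
    Dy⊆Dx = ⊆φ⇒φ⊆φ (∪-least (x∈p⇒⁅x⁆⊆p y∈Dx) (λ z∈φX → extensive _ (q⊆p∪q _ _ z∈φX)))
    x∈Dy : x ∈ Dy
    x∈Dy = decidable-stable (x ∈? Dy) λ x∉Dy →
      let _ , _ , _ , nothing-between = φX⋖φ⁅x⁆∪φX x∉φX
          _ , Dy-closed , φX⊂Dy , _   = φX⋖φ⁅x⁆∪φX y∉φX
      in  nothing-between Dy Dy-closed φX⊂Dy (Dy⊆Dx , x , extensive _ (p⊆p∪q _ (x∈⁅x⁆ x)) , x∉Dy)
    ⁅y⁆∪φX⊆φX∪y : ⁅ y ⁆ ∪ φ X ⊆ φ (X ∪ ⁅ y ⁆)
    ⁅y⁆∪φX⊆φX∪y = ∪-least (λ z∈⁅y⁆ → extensive _ (q⊆p∪q _ _ z∈⁅y⁆)) (monotone (p⊆p∪q _))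

  MinimalGenerator-exchange : MinimalGenerator x A → c ∈ A → c ∈ φ ((A - c) ∪ ⁅ x ⁆)
  MinimalGenerator-exchange {A = A} {c} mg@(x∈φA , _) c∈A =
    exchange (monotone (p⊆p-x∪⁅x⁆ A c) x∈φA) (MinimalGenerator⇒∉φ- mg c∈A)

  ∈ᵇ⇔∈ : (_∈ᵇ_ cl y X) ⇔ (y ∈ X)
  ∈ᵇ⇔∈ {y} {X} = mk⇔ (λ (x , x∈X , y∈φ⁅x⁆) → subst (_∈ X) (sym (∈φ⁅x⁆⇒≡ y∈φ⁅x⁆)) x∈X)
                     (λ y∈X → y , y∈X , x∈φ⁅x⁆ y)

  ⊂ᵇ⇔⊂ : (_⊂ᵇ_ cl B A) ⇔ (B ⊂ A)
  ⊂ᵇ⇔⊂ = mk⇔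
    (λ (⊆ᵇ , y , y∈ᵇA , y∉ᵇB) → (λ y∈B → to ∈ᵇ⇔∈ (⊆ᵇ _ (from ∈ᵇ⇔∈ y∈B))) ,
                                 y , to ∈ᵇ⇔∈ y∈ᵇA , y∉ᵇB ∘ from ∈ᵇ⇔∈)
    (λ (B⊆A , y , y∈A , y∉B) → (λ _ y∈ᵇB → from ∈ᵇ⇔∈ (B⊆A (to ∈ᵇ⇔∈ y∈ᵇB))) ,
                                y , from ∈ᵇ⇔∈ y∈A , y∉B ∘ to ∈ᵇ⇔∈)

  DGenerator⇔ : DGenerator cl x A ⇔ (x ∉ A × MinimalGenerator x A)
  DGenerator⇔ = mk⇔
    (λ (x∈φA , x∉ᵇA , minimal) → x∉ᵇA ∘ from ∈ᵇ⇔∈ , x∈φA , λ B → minimal B ∘ from ⊂ᵇ⇔⊂)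
    (λ (x∉A , x∈φA , minimal) → x∈φA , x∉A ∘ to ∈ᵇ⇔∈ , λ B → minimal B ∘ to ⊂ᵇ⇔⊂)

  EGenerator⇒¬GeneratedBelow : EGenerator cl x A → ¬ GeneratedBelow (φ A) x
  EGenerator⇒¬GeneratedBelow (_ , least) (B , x∉B , x∈φB , φB⊂φA) =
    let B′ , B′⊆B , mgB′ = minimalGenerator x∈φB
    in  least B′ (from DGenerator⇔ (x∉B ∘ B′⊆B , mgB′)) (⊆-⊂-trans (monotone B′⊆B) φB⊂φA)

  EBaseClosed-intro : (∀ A → A ⊆ C → ∀ x → EGenerator cl x A → x ∈ C) → EBaseClosed cl C
  EBaseClosed-intro _      _ _   _ (inj₁ (_ , _ , x≢a , x∈φ⁅a⁆)) =
    contradiction (∈φ⁅x⁆⇒≡ x∈φ⁅a⁆) x≢a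
  EBaseClosed-intro closed A A⊆C x (inj₂ eg) = closed A A⊆C x eg

  module _ (incomparable : EssentialPairwiseIncomparable cl) where

    Essential⇒EGenerator : Essential cl (φ A) → DGenerator cl x A → EGenerator cl x A
    Essential⇒EGenerator {A} essA dg = dg , λ B dgB φB⊂φA →
      let x∉B , x∈φB , _   = to DGenerator⇔ dgB
          E , essE , E⊆φB = Essential-below (λ φB⊆B → x∉B (φB⊆B x∈φB))
          E≡φA             = incomparable E (φ A) essE essA (⊆-trans E⊆φB (proj₁ φB⊂φA))
          _ , z , z∈φA , z∉φB = φB⊂φA
      in  z∉φB (E⊆φB (subst (z ∈_) (sym E≡φA) z∈φA))

    MinimalEscape⇒EGenerator : MinimalEscape C X → y ∈ φ X → y ∉ C →
                               ∃[ A ] (A ⊆ C × EGenerator cl y A)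
    MinimalEscape⇒EGenerator {C} {X} {y} minEsc@((X⊆C , _) , minimal) y∈φX y∉C
      with minimalGenerator y∈φX
    ... | A , A⊆X , mgA@(y∈φA , _) =
      A , A⊆C , Essential⇒EGenerator essA (from DGenerator⇔ (y∉C ∘ A⊆C , mgA))
      where
      A⊆C : A ⊆ C
      A⊆C a∈A = X⊆C (A⊆X a∈A)
      φA≡φX : φ A ≡ φ X
      φA≡φX = decidable-stable (φ A ≟ˢ φ X) λ φA≢φX →
        y∉C (minimal A (⊆∧≢⇒⊂ (monotone A⊆X) φA≢φX) A⊆C y∈φA)
      essA : Essential cl (φ A)
      essA = subst (Essential cl) (sym φA≡φX) (MinimalEscape⇒Essential minEsc)

    EBaseClosed⇒closed : ∀ C → EBaseClosed cl C → φ C ⊆ C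
    EBaseClosed⇒closed C ebcC = decidable-stable (φ C ⊆? C) λ φC⊈C →
      let X , minEsc@((_ , φX⊈C) , _) , _ = minimalEscape (⊆-refl , φC⊈C)
          y , y∈φX , y∉C = ⊈⇒∃∉ φX⊈C
          A , A⊆C , eg   = MinimalEscape⇒EGenerator minEsc y∈φX y∉C
      in  y∉C (ebcC A A⊆C y (inj₂ eg))

  InResidue : Subset n → Subset n → Fin n → Set
  InResidue G K y = y ∈ φ G × (¬ GeneratedBelow (φ G) y ⊎ y ∈ φ K)

  inResidue? : ∀ G K → Decidable (InResidue G K)
  inResidue? G K y = (y ∈? φ G) ×-dec (¬? (generatedBelow? (φ G) y) ⊎-dec (y ∈? φ K))

  Residue : Subset n → Subset n → Subset n
  Residue G K = select (inResidue? G K)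

  GeneratedBelow-spreads : GeneratedBelow F x → MinimalGenerator x A → φ A ⊂ F → c ∈ A →
                           GeneratedBelow F c
  GeneratedBelow-spreads {x = x} {A} {c} gbx mgA@(x∈φA , _) φA⊂F c∈A with c ≟ᶠ x
  ... | yes refl = gbx
  ... | no c≢x   = (A - c) ∪ ⁅ x ⁆ , c∉B , MinimalGenerator-exchange mgA c∈A ,
                   ⊆-⊂-trans (⊆φ⇒φ⊆φ B⊆φA) φA⊂F
    where
    c∉B : c ∉ (A - c) ∪ ⁅ x ⁆
    c∉B c∈B = [ x∉p-x A c , c≢x ∘ x∈⁅y⁆⇒x≡y x ] (x∈p∪q⁻ _ _ c∈B)
    B⊆φA : (A - c) ∪ ⁅ x ⁆ ⊆ φ A
    B⊆φA = ∪-least (λ y∈A-c → extensive A (p─q⊆p A _ y∈A-c)) (x∈p⇒⁅x⁆⊆p x∈φA)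

  Residue⊆φ : ∀ G K → Residue G K ⊆ φ G
  Residue⊆φ G K y∈R = proj₁ (∈-select⁻ (inResidue? G K) y∈R)

  Residue-EBaseClosed : ∀ G K → EBaseClosed cl (Residue G K)
  Residue-EBaseClosed G K =
    EBaseClosed-intro λ A A⊆R x eg → ∈-select⁺ (inResidue? G K) (inResidue A⊆R eg)
    where
    inResidue : A ⊆ Residue G K → EGenerator cl x A → InResidue G K x
    inResidue {A} {x} A⊆R eg@((x∈φA , _) , _) = ⊆φ⇒φ⊆φ A⊆φG x∈φA , notBelow⊎inφK
      where
      A⊆φG : A ⊆ φ G
      A⊆φG = ⊆-trans A⊆R (Residue⊆φ G K)
      φA⊂φG : GeneratedBelow (φ G) x → φ A ⊂ φ G
      φA⊂φG gbx = ⊆∧≢⇒⊂ (⊆φ⇒φ⊆φ A⊆φG) λ φA≡φG →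
        EGenerator⇒¬GeneratedBelow eg (subst (λ F → GeneratedBelow F x) (sym φA≡φG) gbx)
      A⊆φK : GeneratedBelow (φ G) x → A ⊆ φ K
      A⊆φK gbx m∈A =
        [ (λ ¬gbm → contradiction (GeneratedBelow-spreads gbx mgA (φA⊂φG gbx) m∈A) ¬gbm)
        , (λ m∈φK → m∈φK) ]
        (proj₂ (∈-select⁻ (inResidue? G K) (A⊆R m∈A)))
        where
        mgA : MinimalGenerator x A
        mgA = proj₂ (to DGenerator⇔ (proj₁ eg))
      notBelow⊎inφK : ¬ GeneratedBelow (φ G) x ⊎ x ∈ φ K
      notBelow⊎inφK with generatedBelow? (φ G) x
      ... | no ¬gbx = inj₁ ¬gbx
      ... | yes gbx = inj₂ (⊆φ⇒φ⊆φ (A⊆φK gbx) x∈φA)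

  EGenerator⇒Residue : EGenerator cl x A → GeneratedBelow (φ A) e →
                       ∃[ K ] (φ A ⊆ φ (Residue A K) × e ∉ Residue A K)
  EGenerator⇒Residue {x} {A} {e} eg gbe@(_ , _ , e∈φB , φB⊂φA)
    with minimalGenerator (proj₁ φB⊂φA e∈φB)
  ... | A′ , A′⊆A , mgA′ with ∈φ⇒Nonempty (proj₁ mgA′)
  ... | c , c∈A′ = A - c , φA⊆φR , e∉R
    where
    R : Subset n
    R = Residue A (A - c)
    c∈A : c ∈ A
    c∈A = A′⊆A c∈A′
    mgA : MinimalGenerator x A
    mgA = proj₂ (to DGenerator⇔ (proj₁ eg))
    e∉φA-c : e ∉ φ (A - c)
    e∉φA-c e∈φA-c = MinimalGenerator⇒∉φ- mgA c∈A (⊆φ⇒φ⊆φ A⊆φA-c (proj₁ mgA))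
      where
      c∈φA-c : c ∈ φ (A - c)
      c∈φA-c = ⊆φ⇒φ⊆φ (∪-least (λ y∈A′-c → extensive _ (p⊆q⇒p-x⊆q-x A′⊆A y∈A′-c))
                                (x∈p⇒⁅x⁆⊆p e∈φA-c))
                       (MinimalGenerator-exchange mgA′ c∈A′)
      A⊆φA-c : A ⊆ φ (A - c)
      A⊆φA-c = p-x⊆q∧x∈q⇒p⊆q (extensive (A - c)) c∈φA-c
    e∉R : e ∉ R
    e∉R e∈R = [ (λ ¬gbe → ¬gbe gbe) , e∉φA-c ] (proj₂ (∈-select⁻ (inResidue? A (A - c)) e∈R))
    A-c⊆R : A - c ⊆ R
    A-c⊆R y∈A-c = ∈-select⁺ (inResidue? A (A - c))
                    (extensive A (p─q⊆p A _ y∈A-c) , inj₂ (extensive _ y∈A-c))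
    x∈R : x ∈ R
    x∈R = ∈-select⁺ (inResidue? A (A - c)) (proj₁ mgA , inj₁ (EGenerator⇒¬GeneratedBelow eg))
    φA⊆φR : φ A ⊆ φ R
    φA⊆φR = ⊆φ⇒φ⊆φ (p-x⊆q∧x∈q⇒p⊆q (λ y∈A-c → extensive R (A-c⊆R y∈A-c))
                                  (monotone (∪-least A-c⊆R (x∈p⇒⁅x⁆⊆p x∈R))
                                            (MinimalGenerator-exchange mgA c∈A)))

  module _ (valid : EBaseValid cl) where

    below-EGenerator-closed : EGenerator cl x A → φ B ⊂ φ A → φ B ⊆ B
    below-EGenerator-closed {A = A} {B} eg φB⊂φA = decidable-stable (φ B ⊆? B) λ φB⊈B →
      let e , e∈φB , e∉B   = ⊈⇒∃∉ φB⊈B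
          K , φA⊆φR , e∉R = EGenerator⇒Residue eg (B , e∉B , e∈φB , φB⊂φA)
      in  e∉R (to EBaseValid⇔EBaseClosed⇒closed valid _ (Residue-EBaseClosed A K)
                 (φA⊆φR (proj₁ φB⊂φA e∈φB)))

    EBaseValid⇒incomparable : EssentialPairwiseIncomparable cl
    EBaseValid⇒incomparable _ _ (P , (¬cP , _) , refl) (P′ , (¬cP′ , qcP′ , _) , refl) φP⊆φP′ =
      decidable-stable (φ P ≟ˢ φ P′) λ φP≢φP′ →
        ¬cP′ (⊆-antisym (to EBaseValid⇔EBaseClosed⇒closed valid P′
                           (EBaseClosed-intro (P′-EBaseClosed φP≢φP′)))
                        (extensive P′))
      where
      P′-EBaseClosed : φ P ≢ φ P′ → ∀ A → A ⊆ P′ → ∀ x → EGenerator cl x A → x ∈ P′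
      P′-EBaseClosed φP≢φP′ A A⊆P′ x eg = decidable-stable (x ∈? P′) λ x∉P′ →
        let φA≡φP′ = decidable-stable (φ A ≟ˢ φ P′) λ φA≢φP′ →
                       x∉P′ (qcP′ A A⊆P′ (⊆∧≢⇒⊂ (monotone A⊆P′) φA≢φP′) (proj₁ (proj₁ eg)))
            φP⊂φA  = subst (φ P ⊂_) (sym φA≡φP′) (⊆∧≢⇒⊂ φP⊆φP′ φP≢φP′)
        in  ¬cP (⊆-antisym (below-EGenerator-closed eg φP⊂φA) (extensive P))

theorem3 : (n : ℕ) (cl : ClosureOperator n) → Standard cl → Geometric cl →
    EBaseValid cl ⇔ EssentialPairwiseIncomparable cl
theorem3 n cl standard (atomistic , semimodular) =
  mk⇔ EBaseValid⇒incomparable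
      (λ incomparable → from EBaseValid⇔EBaseClosed⇒closed (EBaseClosed⇒closed incomparable))
  where
  open ClosureSpace cl
  open GeometricClosureSpace cl standard atomistic semimodular
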